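{- Let $0<\alpha<2^{ -8}$ and let $n,d_1,d_2,d_3$ be integers with $d_1,d_2,d_3\ge 5n/16$ and $d_1+d_2+d_3=n\ge 10$. Suppose $H$ is a $3$-partite $3$-graph on the same partition classes $U_1\cup W_1$, $U_2\cup W_2$, $U_3\cup W_3$ as $H'(n;d_1,d_2,d_3)$, and every vertex of $H$ is $\alpha$-good with respect to $H'(n;d_1,d_2,d_3)$. Then $H$ contains a perfect matching.
   Context: A $3$-partite $3$-graph has vertex classes and edges that are $3$-sets meeting each class in exactly one vertex. $H'(n;d_1,d_2,d_3)$ is the $3$-partite $3$-graph with classes $U_i\cup W_i$ ($i\in[3]$), $|W_i|=d_i$, $|U_i|=n-d_i$, whose edges are all $3$-sets with one vertex in each class meeting $W=W_1\cup W_2\cup W_3$ in exactly one or two vertices. The link graph $L^F_v$ of a vertex $v$ in a $3$-graph $F$ is the set of pairs $T$ such that $T\cup\{v\}$ is an edge of $F$. A vertex $v$ of $H$ is $\alpha$-good with respect to a $3$-partite $3$-graph $F$ on the same classes if $|L^F_v\setminus L^H_v|\le \alpha n^2$. A perfect matching is a set of pairwise disjoint edges covering all vertices. -}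

module Defs where

open import Data.Nat using (ℕ; zero; suc; _+_; _*_; _≤_; _<ᵇ_)
open import Data.Bool using (Bool; true; false; _∧_; not; if_then_else_)
open import Data.Fin using (Fin; toℕ)
open import Data.List using (List; map; allFin)
open import Data.Nat.ListAction using (sum)
open import Data.Product using (Σ; _×_; _,_; ∃)
open import Relation.Binary.PropositionalEquality using (_≡_; _≢_)

-- A 3-partite 3-graph whose three vertex classes are each (a copy of) Fin n.
Triple : ℕ → Set
Triple n = Fin n × Fin n × Fin n

Graph3 : ℕ → Set
Graph3 n = Triple n → Bool

-- Convention: W_i = { v ∈ class i : toℕ v < d_i }  (so |W_i| = d_i when d_i ≤ n),
-- U_i = the remaining n - d_i vertices of class i.
inW : {n : ℕ} → ℕ → Fin n → ℕ
inW d v = if toℕ v <ᵇ d then 1 else 0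

meetW : {n : ℕ} → ℕ → ℕ → ℕ → Triple n → ℕ
meetW d₁ d₂ d₃ (a , b , c) = inW d₁ a + inW d₂ b + inW d₃ c

H′ : (n d₁ d₂ d₃ : ℕ) → Graph3 n
H′ n d₁ d₂ d₃ e with meetW d₁ d₂ d₃ e
... | 1 = true
... | 2 = true
... | _ = false

count : {n : ℕ} → (Fin n → ℕ) → ℕ
count {n} f = sum (map f (allFin n))

-- indicator of  T ∈ L^F_v \ L^H_v  (T ∪ {v} edge of F but not of H)
diffInd : {n : ℕ} → Graph3 n → Graph3 n → Triple n → ℕ
diffInd F H e = if F e ∧ not (H e) then 1 else 0

linkDiff₁ linkDiff₂ linkDiff₃ : {n : ℕ} → Graph3 n → Graph3 n → Fin n → ℕ
linkDiff₁ F H v = count (λ b → count (λ c → diffInd F H (v , b , c)))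
linkDiff₂ F H v = count (λ a → count (λ c → diffInd F H (a , v , c)))
linkDiff₃ F H v = count (λ a → count (λ b → diffInd F H (a , b , v)))

-- α = p / q (rational, q > 0).  v is α-good w.r.t. F:  |L^F_v \ L^H_v| ≤ α n²,
-- i.e.  q · |L^F_v \ L^H_v| ≤ p · n².
AllGood : (n p q : ℕ) → Graph3 n → Graph3 n → Set
AllGood n p q F H =
  (∀ v → q * linkDiff₁ F H v ≤ p * (n * n)) ×
  (∀ v → q * linkDiff₂ F H v ≤ p * (n * n)) ×
  (∀ v → q * linkDiff₃ F H v ≤ p * (n * n))

fst₃ snd₃ thd₃ : {n : ℕ} → Triple n → Fin n
fst₃ (a , _ , _) = a
snd₃ (_ , b , _) = b
thd₃ (_ , _ , c) = c

PerfectMatching : {n : ℕ} → Graph3 n → Set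
PerfectMatching {n} H =
  Σ ℕ λ m → Σ (Fin m → Triple n) λ M →
    (∀ i → H (M i) ≡ true) ×
    (∀ i j → i ≢ j →
       (fst₃ (M i) ≢ fst₃ (M j)) × (snd₃ (M i) ≢ snd₃ (M j)) × (thd₃ (M i) ≢ thd₃ (M j))) ×
    (∀ v → ∃ λ i → fst₃ (M i) ≡ v) ×
    (∀ v → ∃ λ i → snd₃ (M i) ≡ v) ×
    (∀ v → ∃ λ i → thd₃ (M i) ≡ v)

module Submission where

-- Split the first class into consecutive blocks of sizes d₁, d₂, d₃.  Permutations
-- (β, γ) are aligned if each (i, β i, γ i) meets W exactly in the coordinate naming
-- the block of i; then (a, β f, γ g) is an edge of H′ whenever a, f, g share a block.
-- An aligned pair exists, and it is a perfect matching once all (i, β i, γ i) are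
-- edges of H.  We descend on the number of defective triples: if (a, β a, γ a) is
-- not an edge, a switch (f, g) inside the block of a makes (a, β f, γ g),
-- (f, β g, γ a), (g, β a, γ f) edges, and composing with 3-cycles removes a defect.
-- A switch exists: otherwise each of the ≥ (d - 1)(d - 2) ordered pairs (f, g) gives
-- an edge of H′ missing from H in the link of a, γ a or β a, which is more than the
-- 3αn² that α-goodness allows, because 3n² < 256 (d - 1)(d - 2).

open import Defs
open import Data.Nat using (ℕ; _+_; _*_; _≤_; _<_)
open import Relation.Binary.PropositionalEquality using (_≡_)

open import Data.Nat using (zero; suc; _∸_; z≤n; s≤s; s≤s⁻¹; z<s; _<ᵇ_; _<?_; >-nonZero)
open import Data.Nat.Properties hiding (_≟_)
import Data.Nat.ListAction as List
open import Data.Bool using (Bool; true; false; if_then_else_)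
open import Data.Bool.Properties using (T-≡; ¬-not) renaming (_≟_ to _≟ᵇ_)
open import Data.Fin using (Fin; zero; suc; toℕ; fromℕ<; punchIn; _≟_)
open import Data.Fin.Patterns using (0F; 1F; 2F)
open import Data.Fin.Properties
  using (toℕ<n; toℕ-fromℕ<; toℕ-injective; opposite-prop; punchInᵢ≢i; any?)
open import Data.Fin.Permutation as Perm using (Permutation′; _⟨$⟩ʳ_; _⟨$⟩ˡ_; _∘ₚ_)
import Data.Fin.Permutation.Components as Components
open import Data.List using (map; tabulate)
open import Data.Product using (Σ-syntax; ∃₂; _×_; _,_; proj₁; proj₂)
open import Data.Sum using (_⊎_; inj₁; inj₂)
open import Data.Empty using (⊥-elim)
open import Function using (_∘_; Equivalence; Injection)
open import Function.Properties.Inverse using (↔⇒↣)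
open import Relation.Nullary using (Dec; yes; no; ¬_; ¬?; _×-dec_)
open import Relation.Nullary.Decidable using (dec-true; dec-false)
open import Relation.Binary.PropositionalEquality
  using (refl; sym; trans; cong; cong₂; subst; _≢_; module ≡-Reasoning)
open import Algebra.Properties.Semiring.Sum +-*-semiring
  using (sum; sum-cong-≗; sum-remove; sum-permute; ∑-comm; ∑-distrib-+; *-distribʳ-sum)
open import Data.Nat.Solver using (module +-*-Solver)

sum-map-tabulate : ∀ {n} {A : Set} (f : A → ℕ) (g : Fin n → A) →
                   List.sum (map f (tabulate g)) ≡ sum (f ∘ g)
sum-map-tabulate {zero}  f g = refl
sum-map-tabulate {suc n} f g = cong (f (g zero) +_) (sum-map-tabulate f (g ∘ suc))

-- The operator `count` of Defs is the library's finite sum over Fin n, so the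
-- library's algebra of sums (reindexing, exchange, linearity) applies to links.
count≡sum : ∀ {n} (f : Fin n → ℕ) → count f ≡ sum f
count≡sum f = sum-map-tabulate f (λ i → i)

count²≡sum² : ∀ {n} (h : Fin n → Fin n → ℕ) →
              count (λ x → count (h x)) ≡ sum (λ x → sum (h x))
count²≡sum² h = trans (count≡sum (λ x → count (h x))) (sum-cong-≗ (λ x → count≡sum (h x)))

sum-mono : ∀ {n} {f g : Fin n → ℕ} → (∀ i → f i ≤ g i) → sum f ≤ sum g
sum-mono {zero}  f≤g = z≤n
sum-mono {suc n} f≤g = +-mono-≤ (f≤g zero) (sum-mono (f≤g ∘ suc))

sum-strict : ∀ {n} {f g : Fin n → ℕ} (x : Fin n) →
             (∀ i → f i ≤ g i) → f x < g x → sum f < sum g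
sum-strict {suc n} {f} {g} x f≤g fx<gx = begin-strict
  sum f                       ≡⟨ sum-remove {i = x} f ⟩
  f x + sum (f ∘ punchIn x)   <⟨ +-mono-<-≤ fx<gx (sum-mono (f≤g ∘ punchIn x)) ⟩
  g x + sum (g ∘ punchIn x)   ≡⟨ sum-remove {i = x} g ⟨
  sum g                       ∎
  where open ≤-Reasoning

sum²-+ : ∀ {n} (u v : Fin n → Fin n → ℕ) →
         sum (λ f → sum (λ g → u f g + v f g)) ≡ sum (λ f → sum (u f)) + sum (λ f → sum (v f))
sum²-+ u v = trans (sum-cong-≗ (λ f → ∑-distrib-+ (u f) (v f)))
                   (∑-distrib-+ (λ f → sum (u f)) (λ f → sum (v f)))

sum-reindex : ∀ {n} (π : Permutation′ n) (h : Fin n → ℕ) →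
              sum (λ i → h (π ⟨$⟩ʳ i)) ≡ sum h
sum-reindex π h = sym (sum-permute h π)

𝟙[_] : {A : Set} → Dec A → ℕ
𝟙[ yes _ ] = 1
𝟙[ no _ ]  = 0

size : ∀ {n} {P : Fin n → Set} → (∀ i → Dec (P i)) → ℕ
size P? = sum (λ i → 𝟙[ P? i ])

interval-size : ∀ {N} {P : Fin N → Set} (P? : ∀ i → Dec (P i)) (lo d : ℕ) → lo + d ≤ N →
                (∀ i → lo ≤ toℕ i → toℕ i < lo + d → P i) → d ≤ size P?
interval-size             P? lo      zero    _         _   = z≤n
interval-size {suc N}     P? zero    (suc d) (s≤s d≤N) inP with P? zero
... | yes _  = s≤s (interval-size (P? ∘ suc) zero d d≤N (λ i _ i<d → inP (suc i) z≤n (s≤s i<d)))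
... | no ¬p0 = ⊥-elim (¬p0 (inP zero z≤n (s≤s z≤n)))
interval-size {suc N} P? (suc lo) (suc d) (s≤s le) inP =
  ≤-trans (interval-size (P? ∘ suc) lo (suc d) le (λ i l u → inP (suc i) (s≤s l) (s≤s u)))
          (m≤n+m _ 𝟙[ P? zero ])

size-delete : ∀ {n} {P : Fin n → Set} (P? : ∀ i → Dec (P i)) (x : Fin n) →
              size P? ≤ 1 + size (λ i → P? i ×-dec ¬? (i ≟ x))
size-delete {suc n} {P} P? x = begin
  size P?                              ≡⟨ sum-remove {i = x} (λ i → 𝟙[ P? i ]) ⟩
  𝟙[ P? x ] + sum (λ k → 𝟙[ P? (punchIn x k) ])
    ≤⟨ +-mono-≤ (𝟙≤1 (P? x))
                (≤-reflexive (sum-cong-≗ (λ k → off-x (punchIn x k) (punchInᵢ≢i x k)))) ⟩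
  1 + sum (λ k → 𝟙[ Q? (punchIn x k) ]) ≤⟨ +-monoʳ-≤ 1 (m≤n+m _ 𝟙[ Q? x ]) ⟩
  1 + (𝟙[ Q? x ] + sum (λ k → 𝟙[ Q? (punchIn x k) ]))
    ≡⟨ cong (1 +_) (sum-remove {i = x} (λ i → 𝟙[ Q? i ])) ⟨
  1 + size Q?                          ∎
  where
  open ≤-Reasoning
  Q? : ∀ i → Dec (P i × i ≢ x)
  Q? i = P? i ×-dec ¬? (i ≟ x)
  𝟙≤1 : ∀ {A : Set} (a? : Dec A) → 𝟙[ a? ] ≤ 1
  𝟙≤1 (yes _) = ≤-refl
  𝟙≤1 (no _)  = z≤n
  off-x : ∀ i → i ≢ x → 𝟙[ P? i ] ≡ 𝟙[ Q? i ]
  off-x i i≢x with P? i | i ≟ x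
  ... | _     | yes i≡x = ⊥-elim (i≢x i≡x)
  ... | yes _ | no _    = refl
  ... | no _  | no _    = refl

pairs-lower-bound : ∀ {n} {P : Fin n → Set} (P? : ∀ i → Dec (P i)) (D : Fin n → Fin n → ℕ) →
                    (∀ f g → P f → P g → g ≢ f → 1 ≤ D f g) →
                    size P? * (size P? ∸ 1) ≤ sum (λ f → sum (D f))
pairs-lower-bound P? D weight = begin
  size P? * (size P? ∸ 1)                  ≡⟨ *-distribʳ-sum (size P? ∸ 1) (λ i → 𝟙[ P? i ]) ⟩
  sum (λ f → 𝟙[ P? f ] * (size P? ∸ 1))   ≤⟨ sum-mono row ⟩
  sum (λ f → sum (D f))                    ∎
  where
  open ≤-Reasoning
  row : ∀ f → 𝟙[ P? f ] * (size P? ∸ 1) ≤ sum (D f)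
  row f with P? f
  ... | no _   = z≤n
  ... | yes pf = begin
    1 * (size P? ∸ 1)                        ≡⟨ *-identityˡ _ ⟩
    size P? ∸ 1                              ≤⟨ m≤n+o⇒m∸n≤o (size P?) 1 (size-delete P? f) ⟩
    size (λ g → P? g ×-dec ¬? (g ≟ f))       ≤⟨ sum-mono weighted ⟩
    sum (D f)                                ∎
    where
    weighted : ∀ g → 𝟙[ P? g ×-dec ¬? (g ≟ f) ] ≤ D f g
    weighted g with P? g ×-dec ¬? (g ≟ f)
    ... | yes (pg , g≢f) = weight f g pf pg g≢f
    ... | no _           = z≤n

reflectN : ℕ → ℕ → ℕ
reflectN A x with x <? A
... | yes _ = A ∸ suc x
... | no _  = x

reflectN-below : ∀ {A x} → x < A → reflectN A x ≡ A ∸ suc x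
reflectN-below {A} {x} x<A with x <? A
... | yes _  = refl
... | no x≮A = ⊥-elim (x≮A x<A)

reflectN-above : ∀ {A x} → A ≤ x → reflectN A x ≡ x
reflectN-above {A} {x} A≤x with x <? A
... | yes x<A = ⊥-elim (<⇒≱ x<A A≤x)
... | no _    = refl

reflect-< : ∀ {A x} → x < A → A ∸ suc x < A
reflect-< {suc A} {x} (s≤s x≤A) = s≤s (m∸n≤m A x)

reflect-twice : ∀ {A x} → x < A → A ∸ suc (A ∸ suc x) ≡ x
reflect-twice {suc A} (s≤s x≤A) = m∸[m∸n]≡n x≤A

reflectN-involutive : ∀ A x → reflectN A (reflectN A x) ≡ x
reflectN-involutive A x with x <? A
... | yes x<A = trans (reflectN-below (reflect-< x<A)) (reflect-twice x<A)
... | no x≮A  = reflectN-above (≮⇒≥ x≮A)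

reflectN-< : ∀ {A N x} → A ≤ N → x < N → reflectN A x < N
reflectN-< {A} {N} {x} A≤N x<N with x <? A
... | yes x<A = <-≤-trans (reflect-< x<A) A≤N
... | no _    = x<N

reflect-lands-high : ∀ {A B x} → x < A → B ≤ (A + B) ∸ suc x
reflect-lands-high {A} {B} {x} x<A =
  m+n≤o⇒m≤o∸n B (subst (_≤ A + B) (+-comm (suc x) B) (+-monoˡ-≤ B x<A))

reflect-lands-low : ∀ {A B x} → A ≤ x → x < A + B → (A + B) ∸ suc x < B
reflect-lands-low {A} {B} {x} A≤x x<A+B =
  subst (_≤ B) (+-∸-assoc 1 x<A+B) (m≤n+o⇒m∸n≤o (A + B) x (+-monoˡ-≤ B A≤x))

prefixReverse : ∀ {N} A → A ≤ N → Permutation′ N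
prefixReverse A A≤N = Perm.permutation reflect reflect involutive involutive
  where
  reflect : Fin _ → Fin _
  reflect i = fromℕ< (reflectN-< A≤N (toℕ<n i))
  involutive : ∀ i → reflect (reflect i) ≡ i
  involutive i = toℕ-injective (begin
    toℕ (reflect (reflect i))        ≡⟨ toℕ-fromℕ< _ ⟩
    reflectN A (toℕ (reflect i))     ≡⟨ cong (reflectN A) (toℕ-fromℕ< _) ⟩
    reflectN A (reflectN A (toℕ i))  ≡⟨ reflectN-involutive A (toℕ i) ⟩
    toℕ i                            ∎)
    where open ≡-Reasoning

prefixReverse-toℕ : ∀ {N} A (A≤N : A ≤ N) i →
                    toℕ (prefixReverse A A≤N ⟨$⟩ʳ i) ≡ reflectN A (toℕ i)
prefixReverse-toℕ A A≤N i = toℕ-fromℕ< _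

transpose-left : ∀ {n} (i j : Fin n) → Components.transpose i j i ≡ j
transpose-left i j rewrite dec-true (i ≟ i) refl = refl

transpose-right : ∀ {n} (i j : Fin n) → Components.transpose i j j ≡ i
transpose-right i j with j ≟ i
... | yes j≡i = j≡i
... | no _ rewrite dec-true (j ≟ j) refl = refl

transpose-other : ∀ {n} {i j k : Fin n} → k ≢ i → k ≢ j → Components.transpose i j k ≡ k
transpose-other {i = i} {j} {k} k≢i k≢j rewrite dec-false (k ≟ i) k≢i | dec-false (k ≟ j) k≢j = refl

transpose-invariant : ∀ {n} {X : Set} (h : Fin n → X) {i j : Fin n} → h i ≡ h j →
                      ∀ k → h (Components.transpose i j k) ≡ h k
transpose-invariant h {i} {j} hi≡hj k = by-cases (k ≟ i) (k ≟ j)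
  where
  by-cases : Dec (k ≡ i) → Dec (k ≡ j) → h (Components.transpose i j k) ≡ h k
  by-cases (yes refl) _          = trans (cong h (transpose-left i j)) (sym hi≡hj)
  by-cases (no _)     (yes refl) = trans (cong h (transpose-right i j)) hi≡hj
  by-cases (no k≢i)   (no k≢j)   = cong h (transpose-other k≢i k≢j)

Distinct₃ : ∀ {n} → Fin n → Fin n → Fin n → Set
Distinct₃ a b c = (a ≢ b) × (b ≢ c) × (c ≢ a)

-- The 3-cycle a ↦ b ↦ c ↦ a.
cycle : ∀ {n} → Fin n → Fin n → Fin n → Permutation′ n
cycle a b c = Perm.transpose b c ∘ₚ Perm.transpose a b

cycle-a : ∀ {n} {a b c : Fin n} → Distinct₃ a b c → cycle a b c ⟨$⟩ʳ a ≡ b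
cycle-a {a = a} {b} {c} (a≢b , _ , c≢a) =
  trans (cong (Components.transpose a b) (transpose-other a≢b (c≢a ∘ sym))) (transpose-left a b)

cycle-b : ∀ {n} {a b c : Fin n} → Distinct₃ a b c → cycle a b c ⟨$⟩ʳ b ≡ c
cycle-b {a = a} {b} {c} (_ , b≢c , c≢a) =
  trans (cong (Components.transpose a b) (transpose-left b c)) (transpose-other c≢a (b≢c ∘ sym))

cycle-c : ∀ {n} (a b c : Fin n) → cycle a b c ⟨$⟩ʳ c ≡ a
cycle-c a b c = trans (cong (Components.transpose a b) (transpose-right b c)) (transpose-right a b)

cycle-elsewhere : ∀ {n} {a b c i : Fin n} → i ≢ a → i ≢ b → i ≢ c → cycle a b c ⟨$⟩ʳ i ≡ i
cycle-elsewhere {a = a} {b} i≢a i≢b i≢c =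
  trans (cong (Components.transpose a b) (transpose-other i≢b i≢c)) (transpose-other i≢a i≢b)

cycle-invariant : ∀ {n} {X : Set} (h : Fin n → X) {a b c : Fin n} → h a ≡ h b → h b ≡ h c →
                  ∀ i → h (cycle a b c ⟨$⟩ʳ i) ≡ h i
cycle-invariant h {a} {b} {c} ha≡hb hb≡hc i =
  trans (transpose-invariant h ha≡hb (Components.transpose b c i)) (transpose-invariant h hb≡hc i)

transversal-matching : ∀ {n} (H : Graph3 n) (β γ : Permutation′ n) →
                       (∀ i → H (i , β ⟨$⟩ʳ i , γ ⟨$⟩ʳ i) ≡ true) → PerfectMatching H
transversal-matching {n} H β γ edges =
  n , (λ i → i , β ⟨$⟩ʳ i , γ ⟨$⟩ʳ i) , edges ,
  (λ i j i≢j → i≢j , i≢j ∘ injective β , i≢j ∘ injective γ) ,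
  (λ v → v , refl) , (λ v → β ⟨$⟩ˡ v , Perm.inverseʳ β) , (λ v → γ ⟨$⟩ˡ v , Perm.inverseʳ γ)
  where
  injective : ∀ (π : Permutation′ n) {i j} → π ⟨$⟩ʳ i ≡ π ⟨$⟩ʳ j → i ≡ j
  injective π = Injection.injective (↔⇒↣ π)

link₁-reindexed : ∀ {n} (F H : Graph3 n) (β γ : Permutation′ n) a →
                  sum (λ f → sum (λ g → diffInd F H (a , β ⟨$⟩ʳ f , γ ⟨$⟩ʳ g))) ≡ linkDiff₁ F H a
link₁-reindexed F H β γ a = begin
  sum (λ f → sum (λ g → diffInd F H (a , β ⟨$⟩ʳ f , γ ⟨$⟩ʳ g)))
    ≡⟨ sum-cong-≗ (λ f → sum-reindex γ (λ c → diffInd F H (a , β ⟨$⟩ʳ f , c))) ⟩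
  sum (λ f → sum (λ c → diffInd F H (a , β ⟨$⟩ʳ f , c)))
    ≡⟨ sum-reindex β (λ b → sum (λ c → diffInd F H (a , b , c))) ⟩
  sum (λ b → sum (λ c → diffInd F H (a , b , c)))
    ≡⟨ count²≡sum² (λ b c → diffInd F H (a , b , c)) ⟨
  linkDiff₁ F H a ∎
  where open ≡-Reasoning

link₃-reindexed : ∀ {n} (F H : Graph3 n) (β γ : Permutation′ n) a →
                  sum (λ f → sum (λ g → diffInd F H (f , β ⟨$⟩ʳ g , γ ⟨$⟩ʳ a))) ≡
                  linkDiff₃ F H (γ ⟨$⟩ʳ a)
link₃-reindexed F H β γ a = begin
  sum (λ f → sum (λ g → diffInd F H (f , β ⟨$⟩ʳ g , γ ⟨$⟩ʳ a)))
    ≡⟨ sum-cong-≗ (λ f → sum-reindex β (λ b → diffInd F H (f , b , γ ⟨$⟩ʳ a))) ⟩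
  sum (λ x → sum (λ b → diffInd F H (x , b , γ ⟨$⟩ʳ a)))
    ≡⟨ count²≡sum² (λ x b → diffInd F H (x , b , γ ⟨$⟩ʳ a)) ⟨
  linkDiff₃ F H (γ ⟨$⟩ʳ a) ∎
  where open ≡-Reasoning

link₂-reindexed : ∀ {n} (F H : Graph3 n) (β γ : Permutation′ n) a →
                  sum (λ f → sum (λ g → diffInd F H (g , β ⟨$⟩ʳ a , γ ⟨$⟩ʳ f))) ≡
                  linkDiff₂ F H (β ⟨$⟩ʳ a)
link₂-reindexed F H β γ a = begin
  sum (λ f → sum (λ g → diffInd F H (g , β ⟨$⟩ʳ a , γ ⟨$⟩ʳ f)))
    ≡⟨ ∑-comm (λ f g → diffInd F H (g , β ⟨$⟩ʳ a , γ ⟨$⟩ʳ f)) ⟩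
  sum (λ g → sum (λ f → diffInd F H (g , β ⟨$⟩ʳ a , γ ⟨$⟩ʳ f)))
    ≡⟨ sum-cong-≗ (λ g → sum-reindex γ (λ c → diffInd F H (g , β ⟨$⟩ʳ a , c))) ⟩
  sum (λ x → sum (λ c → diffInd F H (x , β ⟨$⟩ʳ a , c)))
    ≡⟨ count²≡sum² (λ x c → diffInd F H (x , β ⟨$⟩ʳ a , c)) ⟨
  linkDiff₂ F H (β ⟨$⟩ʳ a) ∎
  where open ≡-Reasoning

<ᵇ-true : ∀ {m n} → m < n → (m <ᵇ n) ≡ true
<ᵇ-true m<n = Equivalence.to T-≡ (<⇒<ᵇ m<n)

<ᵇ-false : ∀ {m n} → n ≤ m → (m <ᵇ n) ≡ false
<ᵇ-false {m} {n} n≤m = ¬-not (λ m<ᵇn → <⇒≱ (<ᵇ⇒< m n (Equivalence.from T-≡ m<ᵇn)) n≤m)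

inW-0 : ∀ {n d y} {v : Fin n} → toℕ v ≡ y → d ≤ y → inW d v ≡ 0
inW-0 refl d≤y rewrite <ᵇ-false d≤y = refl

inW-1 : ∀ {n d y} {v : Fin n} → toℕ v ≡ y → y < d → inW d v ≡ 1
inW-1 refl y<d rewrite <ᵇ-true y<d = refl

H′-meets-once : ∀ {n d₁ d₂ d₃} t → meetW d₁ d₂ d₃ t ≡ 1 → H′ n d₁ d₂ d₃ t ≡ true
H′-meets-once t once rewrite once = refl

defect : Bool → ℕ
defect true  = 0
defect false = 1

edge-or-missing : ∀ {n} (F H : Graph3 n) t → F t ≡ true → H t ≡ true ⊎ diffInd F H t ≡ 1
edge-or-missing F H t Ft with H t
... | true  = inj₁ refl
... | false rewrite Ft = inj₂ refl

-- Blocks of the first vertex class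

-- A block is named by the coordinate (0F, 1F or 2F) in which aligned triples meet W.
Block : Set
Block = Fin 3

δ : Block → Block → ℕ
δ k l = 𝟙[ k ≟ l ]

δ-partition : ∀ k → δ 0F k + δ 1F k + δ 2F k ≡ 1
δ-partition 0F = refl
δ-partition 1F = refl
δ-partition 2F = refl

module Blocks (d₁ d₂ d₃ : ℕ) where

  n : ℕ
  n = d₁ + d₂ + d₃

  H′ₙ : Graph3 n
  H′ₙ = H′ n d₁ d₂ d₃

  width : Block → ℕ
  width 0F = d₁
  width 1F = d₂
  width 2F = d₃

  block : Fin n → Block
  block i = if toℕ i <ᵇ d₁ then 0F else (if toℕ i <ᵇ d₁ + d₂ then 1F else 2F)

  block-0 : ∀ {i} → toℕ i < d₁ → block i ≡ 0F
  block-0 i<d₁ rewrite <ᵇ-true i<d₁ = refl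

  block-1 : ∀ {i} → d₁ ≤ toℕ i → toℕ i < d₁ + d₂ → block i ≡ 1F
  block-1 d₁≤i i<d₁₂ rewrite <ᵇ-false d₁≤i | <ᵇ-true i<d₁₂ = refl

  block-2 : ∀ {i} → d₁ + d₂ ≤ toℕ i → block i ≡ 2F
  block-2 {i} d₁₂≤i
    rewrite <ᵇ-false {toℕ i} {d₁} (≤-trans (m≤m+n d₁ d₂) d₁₂≤i) | <ᵇ-false d₁₂≤i = refl

  inW₁-block : ∀ i → inW d₁ i ≡ δ 0F (block i)
  inW₁-block i with toℕ i <ᵇ d₁
  ... | true  = refl
  ... | false with toℕ i <ᵇ d₁ + d₂
  ...   | true  = refl
  ...   | false = refl

  block-size : ∀ k → width k ≤ size (λ i → block i ≟ k)
  block-size 0F = interval-size _ 0 d₁ (≤-trans (m≤m+n d₁ d₂) (m≤m+n _ d₃))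
                                (λ i _ i<d₁ → block-0 i<d₁)
  block-size 1F = interval-size _ d₁ d₂ (m≤m+n _ d₃) (λ i d₁≤i i<d₁₂ → block-1 d₁≤i i<d₁₂)
  block-size 2F = interval-size _ (d₁ + d₂) d₃ ≤-refl (λ i d₁₂≤i _ → block-2 d₁₂≤i)

  AlignedAt : Permutation′ n → Permutation′ n → Fin n → Set
  AlignedAt β γ i = (inW d₂ (β ⟨$⟩ʳ i) ≡ δ 1F (block i)) × (inW d₃ (γ ⟨$⟩ʳ i) ≡ δ 2F (block i))

  Aligned : Permutation′ n → Permutation′ n → Set
  Aligned β γ = ∀ i → AlignedAt β γ i

  aligned-edge : ∀ {β γ} → Aligned β γ → ∀ {a f g} → block f ≡ block a → block g ≡ block a →
                 H′ₙ (a , β ⟨$⟩ʳ f , γ ⟨$⟩ʳ g) ≡ true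
  aligned-edge {β} {γ} aligned {a} {f} {g} f∼a g∼a =
    H′-meets-once {n} {d₁} {d₂} {d₃} (a , β ⟨$⟩ʳ f , γ ⟨$⟩ʳ g) (begin
    inW d₁ a + inW d₂ (β ⟨$⟩ʳ f) + inW d₃ (γ ⟨$⟩ʳ g)
      ≡⟨ cong₂ _+_ (cong₂ _+_ (inW₁-block a) (trans (proj₁ (aligned f)) (cong (δ 1F) f∼a)))
                   (trans (proj₂ (aligned g)) (cong (δ 2F) g∼a)) ⟩
    δ 0F (block a) + δ 1F (block a) + δ 2F (block a)
      ≡⟨ δ-partition (block a) ⟩
    1 ∎)
    where open ≡-Reasoning

  aligned-∘ : ∀ {β γ σ τ} → Aligned β γ →
              (∀ i → block (σ ⟨$⟩ʳ i) ≡ block i) → (∀ i → block (τ ⟨$⟩ʳ i) ≡ block i) →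
              Aligned (σ ∘ₚ β) (τ ∘ₚ γ)
  aligned-∘ {σ = σ} {τ} aligned σ-keeps τ-keeps i =
    trans (proj₁ (aligned (σ ⟨$⟩ʳ i))) (cong (δ 1F) (σ-keeps i)) ,
    trans (proj₂ (aligned (τ ⟨$⟩ʳ i))) (cong (δ 2F) (τ-keeps i))

  -- An initial aligned pair: reverse [0, d₁ + d₂) in the second class and the whole
  -- third class.
  β₀ γ₀ : Permutation′ n
  β₀ = prefixReverse (d₁ + d₂) (m≤m+n _ d₃)
  γ₀ = Perm.reverse

  aligned₀ : Aligned β₀ γ₀
  aligned₀ i = by-position (toℕ i <? d₁) (toℕ i <? d₁ + d₂)
    where
    β₀-toℕ : toℕ (β₀ ⟨$⟩ʳ i) ≡ reflectN (d₁ + d₂) (toℕ i)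
    β₀-toℕ = prefixReverse-toℕ (d₁ + d₂) (m≤m+n _ d₃) i
    γ₀-toℕ : toℕ (γ₀ ⟨$⟩ʳ i) ≡ n ∸ suc (toℕ i)
    γ₀-toℕ = opposite-prop i
    by-position : Dec (toℕ i < d₁) → Dec (toℕ i < d₁ + d₂) → AlignedAt β₀ γ₀ i
    by-position (yes i<d₁) _ rewrite block-0 {i} i<d₁ =
      inW-0 (trans β₀-toℕ (reflectN-below i<d₁₂)) (reflect-lands-high i<d₁) ,
      inW-0 γ₀-toℕ (reflect-lands-high i<d₁₂)
      where
      i<d₁₂ : toℕ i < d₁ + d₂
      i<d₁₂ = <-≤-trans i<d₁ (m≤m+n d₁ d₂)
    by-position (no i≮d₁) (yes i<d₁₂) rewrite block-1 {i} (≮⇒≥ i≮d₁) i<d₁₂ =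
      inW-1 (trans β₀-toℕ (reflectN-below i<d₁₂)) (reflect-lands-low (≮⇒≥ i≮d₁) i<d₁₂) ,
      inW-0 γ₀-toℕ (reflect-lands-high i<d₁₂)
    by-position (no _) (no i≮d₁₂) rewrite block-2 {i} (≮⇒≥ i≮d₁₂) =
      inW-0 (trans β₀-toℕ (reflectN-above (≮⇒≥ i≮d₁₂))) (≤-trans (m≤n+m d₂ d₁) (≮⇒≥ i≮d₁₂)) ,
      inW-1 γ₀-toℕ (reflect-lands-low (≮⇒≥ i≮d₁₂) (toℕ<n i))

  module Switching (H : Graph3 n) where

    defects : Permutation′ n → Permutation′ n → ℕ
    defects β γ = sum (λ i → defect (H (i , β ⟨$⟩ʳ i , γ ⟨$⟩ʳ i)))

    Edge : Triple n → Set
    Edge t = H t ≡ true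

    Switch : Permutation′ n → Permutation′ n → Fin n → Fin n → Fin n → Set
    Switch β γ a f g = (block f ≡ block a) × (block g ≡ block a) × Distinct₃ a f g ×
                       Edge (a , β ⟨$⟩ʳ f , γ ⟨$⟩ʳ g) × Edge (f , β ⟨$⟩ʳ g , γ ⟨$⟩ʳ a) ×
                       Edge (g , β ⟨$⟩ʳ a , γ ⟨$⟩ʳ f)

    switch? : ∀ β γ a f g → Dec (Switch β γ a f g)
    switch? β γ a f g = block f ≟ block a ×-dec block g ≟ block a ×-dec
                        (¬? (a ≟ f) ×-dec ¬? (f ≟ g) ×-dec ¬? (g ≟ a)) ×-dec
                        edge? _ ×-dec edge? _ ×-dec edge? _
      where
      edge? : ∀ t → Dec (Edge t)
      edge? t = H t ≟ᵇ true

    -- Switching along the 3-cycles σ = (a f g) and τ = (a g f) keeps the pair aligned,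
    -- repairs the defect at a and creates no new defect.
    switch-step : ∀ {β γ a f g} → Aligned β γ → H (a , β ⟨$⟩ʳ a , γ ⟨$⟩ʳ a) ≡ false →
                  Switch β γ a f g →
                  Σ[ β′ ∈ Permutation′ n ] Σ[ γ′ ∈ Permutation′ n ]
                    Aligned β′ γ′ × defects β′ γ′ < defects β γ
    switch-step {β} {γ} {a} {f} {g} aligned broken
                (f∼a , g∼a , distinct@(a≢f , f≢g , g≢a) , edge-a , edge-f , edge-g) =
      σ ∘ₚ β , τ ∘ₚ γ , aligned-∘ {β} {γ} {σ} {τ} aligned σ-keeps τ-keeps ,
      sum-strict a improved repaired
      where
      σ τ : Permutation′ n
      σ = cycle a f g
      τ = cycle a g f
      distinct′ : Distinct₃ a g f
      distinct′ = g≢a ∘ sym , f≢g ∘ sym , a≢f ∘ sym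
      σ-keeps : ∀ i → block (σ ⟨$⟩ʳ i) ≡ block i
      σ-keeps = cycle-invariant block (sym f∼a) (trans f∼a (sym g∼a))
      τ-keeps : ∀ i → block (τ ⟨$⟩ʳ i) ≡ block i
      τ-keeps = cycle-invariant block (sym g∼a) (trans g∼a (sym f∼a))
      new : Fin n → Bool
      new i = H (i , β ⟨$⟩ʳ (σ ⟨$⟩ʳ i) , γ ⟨$⟩ʳ (τ ⟨$⟩ʳ i))
      new-at : ∀ i {x y} → σ ⟨$⟩ʳ i ≡ x → τ ⟨$⟩ʳ i ≡ y →
               Edge (i , β ⟨$⟩ʳ x , γ ⟨$⟩ʳ y) → new i ≡ true
      new-at i refl refl edge = edge
      no-defect : ∀ {i m} → new i ≡ true → defect (new i) ≤ m
      no-defect new-i rewrite new-i = z≤n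
      improved : ∀ i → defect (new i) ≤ defect (H (i , β ⟨$⟩ʳ i , γ ⟨$⟩ʳ i))
      improved i = by-cases (i ≟ a) (i ≟ f) (i ≟ g)
        where
        by-cases : Dec (i ≡ a) → Dec (i ≡ f) → Dec (i ≡ g) →
                   defect (new i) ≤ defect (H (i , β ⟨$⟩ʳ i , γ ⟨$⟩ʳ i))
        by-cases (yes refl) _ _ =
          no-defect (new-at a (cycle-a distinct) (cycle-a distinct′) edge-a)
        by-cases (no _) (yes refl) _ =
          no-defect (new-at f (cycle-b distinct) (cycle-c a g f) edge-f)
        by-cases (no _) (no _) (yes refl) =
          no-defect (new-at g (cycle-c a f g) (cycle-b distinct′) edge-g)
        by-cases (no i≢a) (no i≢f) (no i≢g) =
          ≤-reflexive (cong₂ (λ x y → defect (H (i , β ⟨$⟩ʳ x , γ ⟨$⟩ʳ y)))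
                             (cycle-elsewhere i≢a i≢f i≢g) (cycle-elsewhere i≢a i≢g i≢f))
      repaired : defect (new a) < defect (H (a , β ⟨$⟩ʳ a , γ ⟨$⟩ʳ a))
      repaired rewrite new-at a (cycle-a distinct) (cycle-a distinct′) edge-a | broken = s≤s z≤n

    -- Missing-edge counting: if a has no switch, then each ordered pair (f, g) of
    -- distinct vertices of block a other than a yields an edge of H′ missing from H
    -- in the link of a, of γ a or of β a.
    no-switch-bound : ∀ {β γ} → Aligned β γ → ∀ a → ¬ ∃₂ (Switch β γ a) →
                      (width (block a) ∸ 1) * (width (block a) ∸ 2) ≤
                      linkDiff₁ H′ₙ H a + linkDiff₃ H′ₙ H (γ ⟨$⟩ʳ a) + linkDiff₂ H′ₙ H (β ⟨$⟩ʳ a)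
    no-switch-bound {β} {γ} aligned a no-switch = begin
      (w ∸ 1) * (w ∸ 2)
        ≤⟨ *-mono-≤ w∸1≤s (≤-trans (≤-reflexive (sym (∸-+-assoc w 1 1))) (∸-monoˡ-≤ 1 w∸1≤s)) ⟩
      size others * (size others ∸ 1)
        ≤⟨ pairs-lower-bound others (λ f g → D₁ f g + D₂ f g + D₃ f g) one-missing ⟩
      sum (λ f → sum (λ g → D₁ f g + D₂ f g + D₃ f g))
        ≡⟨ trans (sum²-+ (λ f g → D₁ f g + D₂ f g) D₃)
                 (cong (_+ sum (λ f → sum (D₃ f))) (sum²-+ D₁ D₂)) ⟩
      sum (λ f → sum (D₁ f)) + sum (λ f → sum (D₂ f)) + sum (λ f → sum (D₃ f))
        ≡⟨ cong₂ _+_ (cong₂ _+_ (link₁-reindexed H′ₙ H β γ a) (link₃-reindexed H′ₙ H β γ a))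
                     (link₂-reindexed H′ₙ H β γ a) ⟩
      linkDiff₁ H′ₙ H a + linkDiff₃ H′ₙ H (γ ⟨$⟩ʳ a) + linkDiff₂ H′ₙ H (β ⟨$⟩ʳ a) ∎
      where
      open ≤-Reasoning
      w : ℕ
      w = width (block a)
      others : ∀ i → Dec ((block i ≡ block a) × (i ≢ a))
      others i = block i ≟ block a ×-dec ¬? (i ≟ a)
      w∸1≤s : w ∸ 1 ≤ size others
      w∸1≤s = m≤n+o⇒m∸n≤o w 1
                (≤-trans (block-size (block a)) (size-delete (λ i → block i ≟ block a) a))
      t₁ t₂ t₃ : Fin n → Fin n → Triple n
      t₁ f g = a , β ⟨$⟩ʳ f , γ ⟨$⟩ʳ g
      t₂ f g = f , β ⟨$⟩ʳ g , γ ⟨$⟩ʳ a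
      t₃ f g = g , β ⟨$⟩ʳ a , γ ⟨$⟩ʳ f
      D₁ D₂ D₃ : Fin n → Fin n → ℕ
      D₁ f g = diffInd H′ₙ H (t₁ f g)
      D₂ f g = diffInd H′ₙ H (t₂ f g)
      D₃ f g = diffInd H′ₙ H (t₃ f g)
      in-block : ∀ {x y z} → block y ≡ block x → block z ≡ block x →
                 H′ₙ (x , β ⟨$⟩ʳ y , γ ⟨$⟩ʳ z) ≡ true
      in-block = aligned-edge {β} {γ} aligned
      one-missing : ∀ f g → (block f ≡ block a) × (f ≢ a) → (block g ≡ block a) × (g ≢ a) → g ≢ f →
                    1 ≤ D₁ f g + D₂ f g + D₃ f g
      one-missing f g (f∼a , f≢a) (g∼a , g≢a) g≢f
        with edge-or-missing H′ₙ H (t₁ f g) (in-block f∼a g∼a)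
           | edge-or-missing H′ₙ H (t₂ f g) (in-block (trans g∼a (sym f∼a)) (sym f∼a))
           | edge-or-missing H′ₙ H (t₃ f g) (in-block (sym g∼a) (trans f∼a (sym g∼a)))
      ... | inj₂ m₁ | _       | _       =
        ≤-trans (≤-reflexive (sym m₁)) (≤-trans (m≤m+n _ (D₂ f g)) (m≤m+n _ (D₃ f g)))
      ... | inj₁ _  | inj₂ m₂ | _       =
        ≤-trans (≤-reflexive (sym m₂)) (≤-trans (m≤n+m _ (D₁ f g)) (m≤m+n _ (D₃ f g)))
      ... | inj₁ _  | inj₁ _  | inj₂ m₃ =
        ≤-trans (≤-reflexive (sym m₃)) (m≤n+m _ (D₁ f g + D₂ f g))
      ... | inj₁ e₁ | inj₁ e₂ | inj₁ e₃ =
        ⊥-elim (no-switch (f , g , f∼a , g∼a , (f≢a ∘ sym , g≢f ∘ sym , g≢a) , e₁ , e₂ , e₃))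

    module Descent (p q : ℕ) (good : AllGood n p q H′ₙ H)
                   (dense : ∀ k → 3 * (p * (n * n)) < q * ((width k ∸ 1) * (width k ∸ 2))) where

      -- If a had no switch, its block would force too many missing edges.
      switch-exists : ∀ {β γ} → Aligned β γ → ∀ a → ∃₂ (Switch β γ a)
      switch-exists {β} {γ} aligned a with any? (λ f → any? (λ g → switch? β γ a f g))
      ... | yes switch   = switch
      ... | no no-switch = ⊥-elim (<⇒≱ (dense (block a)) (begin
        q * ((width (block a) ∸ 1) * (width (block a) ∸ 2))
          ≤⟨ *-monoʳ-≤ q (no-switch-bound {β} {γ} aligned a no-switch) ⟩
        q * (L₁ + L₃ + L₂)
          ≡⟨ trans (*-distribˡ-+ q (L₁ + L₃) L₂) (cong (_+ q * L₂) (*-distribˡ-+ q L₁ L₃)) ⟩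
        q * L₁ + q * L₃ + q * L₂
          ≤⟨ +-mono-≤ (+-mono-≤ (good₁ a) (good₃ (γ ⟨$⟩ʳ a))) (good₂ (β ⟨$⟩ʳ a)) ⟩
        p * (n * n) + p * (n * n) + p * (n * n)
          ≡⟨ solve 1 (λ x → x :+ x :+ x := con 3 :* x) refl (p * (n * n)) ⟩
        3 * (p * (n * n)) ∎))
        where
        open ≤-Reasoning
        open +-*-Solver
        good₁ : ∀ v → q * linkDiff₁ H′ₙ H v ≤ p * (n * n)
        good₁ = proj₁ good
        good₂ : ∀ v → q * linkDiff₂ H′ₙ H v ≤ p * (n * n)
        good₂ = proj₁ (proj₂ good)
        good₃ : ∀ v → q * linkDiff₃ H′ₙ H v ≤ p * (n * n)
        good₃ = proj₂ (proj₂ good)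
        L₁ L₂ L₃ : ℕ
        L₁ = linkDiff₁ H′ₙ H a
        L₂ = linkDiff₂ H′ₙ H (β ⟨$⟩ʳ a)
        L₃ = linkDiff₃ H′ₙ H (γ ⟨$⟩ʳ a)

      -- Switch at a defective triple until none is left; the number of defects bounds
      -- the number of steps.
      descend : ∀ m {β γ} → Aligned β γ → defects β γ < m → PerfectMatching H
      descend (suc m) {β} {γ} aligned bound with any? (λ a → H (a , β ⟨$⟩ʳ a , γ ⟨$⟩ʳ a) ≟ᵇ false)
      ... | no none-broken =
        transversal-matching H β γ (λ i → ¬-not (λ broken → none-broken (i , broken)))
      ... | yes (a , broken) with switch-exists {β} {γ} aligned a
      ...   | f , g , switch with switch-step {β} {γ} aligned broken switch
      ...     | β′ , γ′ , aligned′ , fewer =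
        descend m {β′} {γ′} aligned′ (<-≤-trans fewer (s≤s⁻¹ bound))

      perfect-matching : PerfectMatching H
      perfect-matching = descend (suc (defects β₀ γ₀)) {β₀} {γ₀} aligned₀ ≤-refl

-- Numerical estimates

-- Blocks are never tiny: d ≤ 3 would give 16d ≤ 48 < 50 ≤ 5n.
too-small : ∀ {n d} → 10 ≤ n → d ≤ 3 → 16 * d < 5 * n
too-small 10≤n d≤3 = ≤-<-trans (*-monoʳ-≤ 16 d≤3) (<-≤-trans (m<m+n 48 z<s) (*-monoʳ-≤ 5 10≤n))

threshold : ∀ {n d} → 5 * n ≤ 16 * d → 10 ≤ n → 3 * (n * n) < 256 * ((d ∸ 1) * (d ∸ 2))
threshold {d = 0} 5n≤16d 10≤n = ⊥-elim (<⇒≱ (too-small 10≤n z≤n) 5n≤16d)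
threshold {d = 1} 5n≤16d 10≤n = ⊥-elim (<⇒≱ (too-small 10≤n (s≤s z≤n)) 5n≤16d)
threshold {d = 2} 5n≤16d 10≤n = ⊥-elim (<⇒≱ (too-small 10≤n (s≤s (s≤s z≤n))) 5n≤16d)
threshold {d = 3} 5n≤16d 10≤n = ⊥-elim (<⇒≱ (too-small 10≤n ≤-refl) 5n≤16d)
threshold {n} {d = suc (suc (suc (suc e)))} 5n≤16d 10≤n = *-cancelˡ-< 25 _ _ (begin-strict
  25 * (3 * (n * n))                     ≡⟨ scale-square n ⟩
  3 * ((5 * n) * (5 * n))                ≤⟨ *-monoʳ-≤ 3 (*-mono-≤ 5n≤16d 5n≤16d) ⟩
  3 * ((16 * (4 + e)) * (16 * (4 + e)))  ≡⟨ pull-out e ⟩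
  768 * ((4 + e) * (4 + e))              <⟨ m<m+n _ (<-≤-trans z<s (m≤n+m 26112 _)) ⟩
  768 * ((4 + e) * (4 + e)) + surplus    ≡⟨ expand e ⟩
  25 * (256 * ((3 + e) * (2 + e)))       ∎)
  where
  open ≤-Reasoning
  open +-*-Solver
  surplus : ℕ
  surplus = 5632 * (e * e) + 25856 * e + 26112
  scale-square : ∀ x → 25 * (3 * (x * x)) ≡ 3 * ((5 * x) * (5 * x))
  scale-square = solve 1 (λ x → con 25 :* (con 3 :* (x :* x))
                              := con 3 :* ((con 5 :* x) :* (con 5 :* x))) refl
  pull-out : ∀ x → 3 * ((16 * (4 + x)) * (16 * (4 + x))) ≡ 768 * ((4 + x) * (4 + x))
  pull-out = solve 1 (λ x → con 3 :* ((con 16 :* (con 4 :+ x)) :* (con 16 :* (con 4 :+ x)))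
                          := con 768 :* ((con 4 :+ x) :* (con 4 :+ x))) refl
  expand : ∀ x → 768 * ((4 + x) * (4 + x)) + (5632 * (x * x) + 25856 * x + 26112)
                 ≡ 25 * (256 * ((3 + x) * (2 + x)))
  expand = solve 1 (λ x → con 768 :* ((con 4 :+ x) :* (con 4 :+ x))
                          :+ (con 5632 :* (x :* x) :+ con 25856 :* x :+ con 26112)
                        := con 25 :* (con 256 :* ((con 3 :+ x) :* (con 2 :+ x)))) refl

scale : ∀ {p q N X} → 0 < p → 256 * p < q → 3 * N < 256 * X → 3 * (p * N) < q * X
scale {p} {q} {N} {X} 0<p 256p<q 3N<256X = begin-strict
  3 * (p * N)    ≡⟨ solve 2 (λ p N → con 3 :* (p :* N) := p :* (con 3 :* N)) refl p N ⟩
  p * (3 * N)    <⟨ *-monoʳ-< p {{>-nonZero 0<p}} 3N<256X ⟩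
  p * (256 * X)  ≡⟨ solve 2 (λ p X → p :* (con 256 :* X) := con 256 :* p :* X) refl p X ⟩
  256 * p * X    ≤⟨ *-monoˡ-≤ X (<⇒≤ 256p<q) ⟩
  q * X          ∎
  where
  open ≤-Reasoning
  open +-*-Solver

lemma7p2 : (p q : ℕ) → 0 < p → 256 * p < q →
    (n d₁ d₂ d₃ : ℕ) → 5 * n ≤ 16 * d₁ → 5 * n ≤ 16 * d₂ → 5 * n ≤ 16 * d₃ →
    d₁ + d₂ + d₃ ≡ n → 10 ≤ n →
    (H : Graph3 n) → AllGood n p q (H′ n d₁ d₂ d₃) H →
    PerfectMatching H
lemma7p2 p q 0<p 256p<q .(d₁ + d₂ + d₃) d₁ d₂ d₃ 5n≤16d₁ 5n≤16d₂ 5n≤16d₃ refl 10≤n H good =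
  Descent.perfect-matching p q good dense
  where
  open Blocks d₁ d₂ d₃
  open Switching H
  dense : ∀ k → 3 * (p * (n * n)) < q * ((width k ∸ 1) * (width k ∸ 2))
  dense 0F = scale 0<p 256p<q (threshold {d = d₁} 5n≤16d₁ 10≤n)
  dense 1F = scale 0<p 256p<q (threshold {d = d₂} 5n≤16d₂ 10≤n)
  dense 2F = scale 0<p 256p<q (threshold {d = d₃} 5n≤16d₃ 10≤n)
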